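{- For any tree $T$, there is a rooted tree $T'$ with $D(T)=D(T')$ and $D_\ell(T)=D_\ell(T')$.
   Context: A coloring of a graph $G$ is distinguishing if no nontrivial automorphism of $G$ preserves all vertex colors. $D(G)$ is the minimum number of colors in a distinguishing coloring of $G$. Given lists $L=\{L(v)\}_{v\in V(G)}$, $G$ is $L$-distinguishable if there is a distinguishing coloring $f$ with $f(v)\in L(v)$ for all $v$; $D_\ell(G)$ is the minimum $k$ such that $G$ is $L$-distinguishable for every list assignment with all $|L(v)|=k$. A rooted tree is a tree with a distinguished vertex (the root); its automorphisms are the tree automorphisms fixing the root, and $D$, $D_\ell$ of a rooted tree are defined with respect to this automorphism group. -}

module Defs where

open import Data.Nat using (ℕ; suc; _≤_; _<_)
open import Data.Fin using (Fin)
open import Data.Fin.Permutation using (Permutation′; _⟨$⟩ʳ_)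
open import Data.Bool using (Bool; true; false)
open import Data.List using (List; _∷_; []; _++_; length)
open import Data.List.Relation.Unary.Linked using (Linked)
open import Data.List.Relation.Unary.Unique.Propositional using (Unique)
open import Data.Product using (Σ; ∃; _×_; proj₁)
open import Relation.Nullary using (¬_)
open import Relation.Binary.PropositionalEquality using (_≡_)

record Graph (n : ℕ) : Set where
  field
    adj    : Fin n → Fin n → Bool
    sym    : ∀ u v → adj u v ≡ adj v u
    irrefl : ∀ v → adj v v ≡ false
open Graph public

Adj : ∀ {n} → Graph n → Fin n → Fin n → Set
Adj G u v = adj G u v ≡ true

data Walk {n} (G : Graph n) : Fin n → Fin n → Set where
  here : ∀ {u} → Walk G u u
  step : ∀ {u w v} → Adj G u w → Walk G w v → Walk G u v

Connected : ∀ {n} → Graph n → Set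
Connected G = ∀ u v → Walk G u v

-- A cycle: distinct vertices x ∷ xs with at least 3 vertices, consecutive
-- vertices adjacent, and the last adjacent to the first.
IsCycle : ∀ {n} → Graph n → Fin n → List (Fin n) → Set
IsCycle G x xs = (2 ≤ length xs) × Unique (x ∷ xs) × Linked (Adj G) (x ∷ xs ++ x ∷ [])

Acyclic : ∀ {n} → Graph n → Set
Acyclic G = ∀ x xs → ¬ IsCycle G x xs

IsTree : ∀ {n} → Graph n → Set
IsTree G = Connected G × Acyclic G

IsAut : ∀ {n} → Graph n → Permutation′ n → Set
IsAut G σ = ∀ u v → adj G (σ ⟨$⟩ʳ u) (σ ⟨$⟩ʳ v) ≡ adj G u v

-- Automorphisms of the rooted tree (G , r): those fixing the root
IsRootedAut : ∀ {n} → Graph n → Fin n → Permutation′ n → Set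
IsRootedAut G r σ = IsAut G σ × (σ ⟨$⟩ʳ r ≡ r)

Distinguishing : ∀ {n} → (Permutation′ n → Set) → (Fin n → ℕ) → Set
Distinguishing A f = ∀ σ → A σ → (∀ v → f (σ ⟨$⟩ʳ v) ≡ f v) → ∀ v → σ ⟨$⟩ʳ v ≡ v

KDistinguishable : ∀ {n} → (Permutation′ n → Set) → ℕ → Set
KDistinguishable A k = Σ (_ → ℕ) λ f → (∀ v → f v < k) × Distinguishing A f

IsD : ∀ {n} → (Permutation′ n → Set) → ℕ → Set
IsD A d = KDistinguishable A d × (∀ k → KDistinguishable A k → d ≤ k)

ListAssignment : ℕ → ℕ → Set
ListAssignment n k = Σ (Fin n → List ℕ) λ L → ∀ v → Unique (L v) × length (L v) ≡ k

LDistinguishable : ∀ {n} → (Permutation′ n → Set) → (Fin n → List ℕ) → Set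
LDistinguishable A L = Σ (_ → ℕ) λ f → (∀ v → f v ∈ L v) × Distinguishing A f
  where open import Data.List.Membership.Propositional using (_∈_)

KChoosable : ∀ {n} → (Permutation′ n → Set) → ℕ → Set
KChoosable {n} A k = (L : ListAssignment n k) → LDistinguishable A (proj₁ L)

IsDl : ∀ {n} → (Permutation′ n → Set) → ℕ → Set
IsDl A d = KChoosable A d × (∀ k → KChoosable A k → d ≤ k)

module Submission where

-- For a tree T, the paper takes T′ to be T rooted at its center.  By
-- Jordan's theorem the center of T is a vertex c fixed by every automorphism,
-- or an edge {a , b} mapped to itself by every automorphism.  In the first
-- case the automorphisms of T and of the rooted tree (T , c) coincide.  In
-- the second case T′ subdivides the edge {a , b} by a new root; automorphisms
-- of T′ fixing the root are exactly lifts of automorphisms of T, so a coloring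
-- of T′ is distinguishing iff its restriction to T is.  Either way D and D_ℓ
-- agree, because they only depend on which colorings are distinguishing.

open import Defs hiding (sym)
open import Data.Nat using (ℕ; zero; suc; _≤_; _<_; _*_; _+_; z≤n; s≤s; pred) renaming (_≟_ to _≟ℕ_)
open import Data.Nat.Properties using (≤-refl; ≤-reflexive; ≤-pred; ≤-trans; ≮⇒≥; m<1+n⇒m<n∨m≡n; <-≤-trans; +-mono-≤; +-mono-<-≤; +-mono-≤-<)
open import Data.Fin using (Fin; zero; suc; toℕ; fromℕ<; punchIn; punchOut)
open import Data.Fin.Properties using (any?; all?; toℕ<n; toℕ-fromℕ<; toℕ-injective; suc-injective) renaming (_≟_ to _≟F_)
open import Data.Fin.Permutation using (Permutation′; _⟨$⟩ʳ_; _⟨$⟩ˡ_; _≈_; insert; remove; insert-remove; lift₀; lift₀-remove; flip; inverseʳ; inverseˡ) renaming (id to idₚ)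
open import Data.Bool using (Bool; true; false; _∧_; not; if_then_else_)
open import Data.Bool.Properties using (∧-comm; ∧-identityʳ; ∧-conicalˡ) renaming (_≟_ to _≟B_)
open import Data.Vec using (Vec; []; _∷_)
open import Data.Vec.Functional using () renaming (_∷_ to _∷ᶠ_)
open import Data.List using (List; []; _∷_; length; _++_; map; _∷ʳ_; initLast; _∷ʳ′_)
open import Data.List.Properties using (length-++; length-map; length-++-sucʳ; length-++-comm; map-++; ++-assoc)
open import Data.List.Membership.Propositional using (_∈_; _∉_)
open import Data.List.Membership.Propositional.Properties using (∈-map⁻; ∈-++⁺ˡ; ∈-++⁺ʳ; ∈-∃++)
import Data.List.Membership.DecPropositional as DecMembership
open import Data.List.Relation.Unary.Any using (here; there)
open import Data.List.Relation.Unary.All as All using (All; []; _∷_)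
open import Data.List.Relation.Unary.All.Properties using (¬Any⇒All¬)
open import Data.List.Relation.Unary.Linked as Linked using (Linked; []; [-]; _∷_)
import Data.List.Relation.Unary.Linked.Properties as LinkedProps
open import Data.List.Relation.Unary.Unique.Propositional using (Unique; []; _∷_)
import Data.List.Relation.Unary.Unique.Propositional.Properties as UniqueProps
open import Data.List.Relation.Unary.Unique.DecPropositional _≟ℕ_ using (unique?)
import Data.List.Relation.Binary.Permutation.Setoid.Properties as PermutationProps
open import Data.Product using (Σ; ∃; ∃₂; _×_; _,_; proj₁; proj₂)
open import Data.Sum using (_⊎_; inj₁; inj₂; [_,_]′)
open import Data.Empty using (⊥-elim)
open import Function using (_∘_; case_of_)
open import Function.Bundles using (mk⇔)
open import Relation.Nullary using (¬_; Dec; yes; no; does)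
open import Relation.Nullary.Decidable using (map′; _×-dec_; ¬?; decidable-stable; dec-true; dec-false; does-⇔)
open import Relation.Unary as U using ()
open import Relation.Binary.PropositionalEquality using (_≡_; refl; sym; trans; cong; cong₂; subst; _≢_; setoid)

-- Without function extensionality, predicates on functions and
-- on permutations must be assumed to respect pointwise equality.
Searchable : Set → Set₁
Searchable X = (P : X → Set) → U.Decidable P → Dec (∃ P)

RespectsPointwise : ∀ {A X : Set} → ((A → X) → Set) → Set
RespectsPointwise P = ∀ {f g} → (∀ a → f a ≡ g a) → P f → P g

PermRespects : ∀ {m} → (Permutation′ m → Set) → Set
PermRespects P = ∀ σ τ → σ ≈ τ → P σ → P τ

search-Fin : ∀ k → Searchable (Fin k)
search-Fin k P P? = any? P?

search-Vec : ∀ {X} → Searchable X → ∀ k → Searchable (Vec X k)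
search-Vec S zero P P? = map′ ([] ,_) (λ { ([] , p) → p }) (P? [])
search-Vec S (suc k) P P? =
  map′ (λ (x , v , p) → x ∷ v , p) (λ { (x ∷ v , p) → x , v , p })
       (S _ (λ x → search-Vec S k (P ∘ (x ∷_)) (P? ∘ (x ∷_))))

search-Fun : ∀ {X} → Searchable X → ∀ m (P : (Fin m → X) → Set) →
  U.Decidable P → RespectsPointwise P → Dec (∃ P)
search-Fun {X} S zero P P? resp = map′ (empty ,_) (λ (f , p) → resp (λ ()) p) (P? empty)
  where
  empty : Fin 0 → X
  empty ()
search-Fun S (suc m) P P? resp =
  map′ (λ (x , g , p) → x ∷ᶠ g , p)
       (λ (f , p) → f zero , f ∘ suc , resp (λ { zero → refl ; (suc i) → refl }) p)
       (S _ (λ x → search-Fun S m (P ∘ (x ∷ᶠ_)) (P? ∘ (x ∷ᶠ_))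
                     (λ f≗g → resp (λ { zero → refl ; (suc i) → f≗g i }))))

insert-cong : ∀ {m} (i j : Fin (suc m)) {ρ ρ′ : Permutation′ m} → ρ ≈ ρ′ → insert i j ρ ≈ insert i j ρ′
insert-cong i j ρ≈ρ′ k with i ≟F k
... | yes _ = refl
... | no i≢k = cong (punchIn j) (ρ≈ρ′ (punchOut i≢k))

-- A permutation of Fin (suc m) is determined by the image j of zero and a
-- permutation of the remaining m points: it is  insert zero j ρ.
search-Perm : ∀ m (P : Permutation′ m → Set) → U.Decidable P → PermRespects P → Dec (∃ P)
search-Perm zero P P? resp = map′ (idₚ ,_) (λ (σ , p) → resp σ idₚ (λ ()) p) (P? idₚ)
search-Perm (suc m) P P? resp =
  map′ (λ (j , ρ , p) → insert zero j ρ , p)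
       (λ (σ , p) → σ ⟨$⟩ʳ zero , remove zero σ , resp σ _ (sym ∘ insert-remove zero σ) p)
       (any? λ j → search-Perm m (P ∘ insert zero j) (P? ∘ insert zero j) (λ ρ ρ′ → resp _ _ ∘ insert-cong zero j))

Least : (ℕ → Set) → Set
Least P = Σ ℕ λ d → P d × (∀ k → P k → d ≤ k)

module _ {P : ℕ → Set} (P? : U.Decidable P) where

  least-or-none-below : ∀ b → Least P ⊎ (∀ k → k < b → ¬ P k)
  least-or-none-below zero = inj₂ λ _ ()
  least-or-none-below (suc b) with least-or-none-below b | P? b
  ... | inj₁ l | _ = inj₁ l
  ... | inj₂ none | yes pb = inj₁ (b , pb , λ k pk → ≮⇒≥ λ k<b → none k k<b pk)
  ... | inj₂ none | no ¬pb = inj₂ λ k k<1+b pk →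
    [ (λ k<b → none k k<b pk) , (λ { refl → ¬pb pk }) ]′ (m<1+n⇒m<n∨m≡n k<1+b)

  least : ∀ b → P b → Least P
  least b pb with least-or-none-below (suc b)
  ... | inj₁ l = l
  ... | inj₂ none = ⊥-elim (none b ≤-refl pb)

colors : ∀ {N k} → Vec (Fin N) k → List ℕ
colors [] = []
colors (x ∷ w) = toℕ x ∷ colors w

length-colors : ∀ {N k} (w : Vec (Fin N) k) → length (colors w) ≡ k
length-colors [] = refl
length-colors (x ∷ w) = cong suc (length-colors w)

colors-bounded : ∀ {N k} (w : Vec (Fin N) k) {x} → x ∈ colors w → x < N
colors-bounded (y ∷ w) (here refl) = toℕ<n y
colors-bounded (y ∷ w) (there p) = colors-bounded w p

colors-onto : ∀ {N} k (xs : List ℕ) → All (_< N) xs → length xs ≡ k →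
  Σ (Vec (Fin N) k) λ w → colors w ≡ xs
colors-onto zero [] _ _ = [] , refl
colors-onto (suc k) (x ∷ xs) (x<N ∷ xs<N) len with colors-onto k xs xs<N (cong pred len)
... | w , refl = fromℕ< x<N ∷ w , cong (_∷ colors w) (toℕ-fromℕ< x<N)

allColors : ∀ m → (Fin m → List ℕ) → List ℕ
allColors zero L = []
allColors (suc m) L = L zero ++ allColors m (L ∘ suc)

∈-allColors : ∀ m (L : Fin m → List ℕ) v {x} → x ∈ L v → x ∈ allColors m L
∈-allColors (suc m) L zero p = ∈-++⁺ˡ p
∈-allColors (suc m) L (suc v) p = ∈-++⁺ʳ (L zero) (∈-allColors m (L ∘ suc) v p)

length-allColors : ∀ m (L : Fin m → List ℕ) k → (∀ v → length (L v) ≡ k) → length (allColors m L) ≡ m * k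
length-allColors zero L k len = refl
length-allColors (suc m) L k len =
  trans (length-++ (L zero)) (cong₂ _+_ (len zero) (length-allColors m (L ∘ suc) k (len ∘ suc)))

position : List ℕ → ℕ → ℕ
position [] x = x
position (y ∷ ys) x with x ≟ℕ y
... | yes _ = zero
... | no _ = suc (position ys x)

entry : List ℕ → ℕ → ℕ
entry [] i = i
entry (y ∷ ys) zero = y
entry (y ∷ ys) (suc i) = entry ys i

entry-position : ∀ U x → entry U (position U x) ≡ x
entry-position [] x = refl
entry-position (y ∷ ys) x with x ≟ℕ y
... | yes x≡y = sym x≡y
... | no _ = entry-position ys x

position-< : ∀ U {x} → x ∈ U → position U x < length U
position-< (y ∷ ys) {x} x∈ with x ≟ℕ y
... | yes _ = s≤s z≤n
position-< (y ∷ ys) (here x≡y) | no x≢y = ⊥-elim (x≢y x≡y)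
position-< (y ∷ ys) (there x∈ys) | no _ = s≤s (position-< ys x∈ys)

position-injective : ∀ U {x y} → position U x ≡ position U y → x ≡ y
position-injective U {x} {y} eq =
  trans (sym (entry-position U x)) (trans (cong (entry U) eq) (entry-position U y))

delete : ℕ → List ℕ → List ℕ
delete x [] = []
delete x (y ∷ ys) with y ≟ℕ x
... | yes _ = delete x ys
... | no _ = y ∷ delete x ys

∈-delete⁻ : ∀ x ys {z} → z ∈ delete x ys → z ∈ ys × z ≢ x
∈-delete⁻ x (y ∷ ys) z∈ with y ≟ℕ x
... | yes _ = let (z∈ys , z≢x) = ∈-delete⁻ x ys z∈ in there z∈ys , z≢x
∈-delete⁻ x (y ∷ ys) (here refl) | no y≢x = here refl , y≢x
∈-delete⁻ x (y ∷ ys) (there z∈) | no _ = let (z∈ys , z≢x) = ∈-delete⁻ x ys z∈ in there z∈ys , z≢x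

delete-unique : ∀ x {ys} → Unique ys → Unique (delete x ys)
delete-unique x [] = []
delete-unique x {y ∷ ys} (y∉ys ∷ u) with y ≟ℕ x
... | yes _ = delete-unique x u
... | no _ = All.tabulate (λ z∈ → All.lookup y∉ys (proj₁ (∈-delete⁻ x ys z∈))) ∷ delete-unique x u

delete-∉ : ∀ x ys → x ∉ ys → delete x ys ≡ ys
delete-∉ x [] _ = refl
delete-∉ x (y ∷ ys) x∉ with y ≟ℕ x
... | yes refl = ⊥-elim (x∉ (here refl))
... | no _ = cong (y ∷_) (delete-∉ x ys (x∉ ∘ there))

length-delete : ∀ x {ys} → Unique ys → length ys ≤ suc (length (delete x ys))
length-delete x [] = z≤n
length-delete x {y ∷ ys} (y∉ys ∷ u) with y ≟ℕ x
... | yes refl = s≤s (≤-reflexive (cong length (sym (delete-∉ y ys (UniqueProps.Unique[x∷xs]⇒x∉xs (y∉ys ∷ u))))))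
... | no _ = s≤s (length-delete x u)

-- Distinct representatives: if each of m vertices has at least
-- m colors available, the vertices can receive pairwise different colors
-- (choose greedily and delete the chosen color from the remaining lists).
distinct-choice : ∀ m (L : Fin m → List ℕ) → (∀ v → Unique (L v)) → (∀ v → m ≤ length (L v)) →
  Σ (Fin m → ℕ) λ f → (∀ v → f v ∈ L v) × (∀ u v → f u ≡ f v → u ≡ v)
distinct-choice zero L _ _ = (λ ()) , (λ ()) , λ ()
distinct-choice (suc m) L u long with L zero in eq | long zero
... | x ∷ _ | _ with distinct-choice m (delete x ∘ L ∘ suc) (delete-unique x ∘ u ∘ suc)
                        (λ v → ≤-pred (≤-trans (long (suc v)) (length-delete x (u (suc v)))))
... | f , f∈ , f-inj = x ∷ᶠ f , chosen∈ , injective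
  where
  chosen∈ : ∀ v → (x ∷ᶠ f) v ∈ L v
  chosen∈ zero = subst (x ∈_) (sym eq) (here refl)
  chosen∈ (suc v) = proj₁ (∈-delete⁻ x (L (suc v)) (f∈ v))
  injective : ∀ u v → (x ∷ᶠ f) u ≡ (x ∷ᶠ f) v → u ≡ v
  injective zero zero _ = refl
  injective zero (suc v) e = ⊥-elim (proj₂ (∈-delete⁻ x (L (suc v)) (f∈ v)) (sym e))
  injective (suc u) zero e = ⊥-elim (proj₂ (∈-delete⁻ x (L (suc u)) (f∈ u)) e)
  injective (suc u) (suc v) e = cong suc (f-inj u v e)

-- D and D_ℓ exist for every decidable family A of permutations of Fin m
-- respecting pointwise equality: being k-distinguishable and k-choosable are
-- decidable and hold for k = m, so each has a least witness.
module Existence {m} (A : Permutation′ m → Set) (A? : U.Decidable A) (A-resp : PermRespects A) where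
  open DecMembership _≟ℕ_ using (_∈?_)

  distinguishing-resp : ∀ {f g : Fin m → ℕ} → (∀ v → f v ≡ g v) → Distinguishing A f → Distinguishing A g
  distinguishing-resp f≗g d σ a pres = d σ a (λ w → trans (f≗g _) (trans (pres w) (sym (f≗g w))))

  injective-distinguishing : ∀ f → (∀ u v → f u ≡ f v → u ≡ v) → Distinguishing A f
  injective-distinguishing f inj σ a pres v = inj _ _ (pres v)

  Breaks : (Fin m → ℕ) → Permutation′ m → Set
  Breaks f σ = A σ × (∀ v → f (σ ⟨$⟩ʳ v) ≡ f v) × ∃ λ v → σ ⟨$⟩ʳ v ≢ v

  breaks? : ∀ f → U.Decidable (Breaks f)
  breaks? f σ = A? σ ×-dec all? (λ v → f (σ ⟨$⟩ʳ v) ≟ℕ f v) ×-dec any? (λ v → ¬? (σ ⟨$⟩ʳ v ≟F v))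

  breaks-resp : ∀ f → PermRespects (Breaks f)
  breaks-resp f σ τ σ≈τ (a , pres , v , moved) =
    A-resp σ τ σ≈τ a , (λ w → trans (cong f (sym (σ≈τ w))) (pres w)) , v , λ τv≡v → moved (trans (σ≈τ v) τv≡v)

  distinguishing? : ∀ f → Dec (Distinguishing A f)
  distinguishing? f with search-Perm m (Breaks f) (breaks? f) (breaks-resp f)
  ... | yes (σ , a , pres , v , moved) = no λ d → moved (d σ a pres v)
  ... | no unbroken = yes λ σ a pres v →
    decidable-stable (σ ⟨$⟩ʳ v ≟F v) λ moved → unbroken (σ , a , pres , v , moved)

  KDistinguishable? : ∀ k → Dec (KDistinguishable A k)
  KDistinguishable? k =
    map′ (λ (g , d) → toℕ ∘ g , toℕ<n ∘ g , d)
         (λ (f , f<k , d) → (λ v → fromℕ< (f<k v)) , distinguishing-resp (λ v → sym (toℕ-fromℕ< (f<k v))) d)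
         (search-Fun (search-Fin k) m (Distinguishing A ∘ (toℕ ∘_)) (distinguishing? ∘ (toℕ ∘_))
                     (λ g≗h → distinguishing-resp (cong toℕ ∘ g≗h)))

  D-exists : Σ ℕ (IsD A)
  D-exists = least KDistinguishable? m (toℕ , toℕ<n , injective-distinguishing toℕ (λ _ _ → toℕ-injective))

  PaletteChoosable : ℕ → Set
  PaletteChoosable k = (L : Fin m → Vec (Fin (m * k)) k) → (∀ v → Unique (colors (L v))) →
    LDistinguishable A (colors ∘ L)

  choosable→palette : ∀ k → KChoosable A k → PaletteChoosable k
  choosable→palette k ch L unique = ch (colors ∘ L , λ v → unique v , length-colors (L v))

  -- An arbitrary assignment of k-lists uses at most m * k colors; renaming
  -- each color by its position among all of them yields a palette assignment,
  -- and renaming a distinguishing choice back keeps it distinguishing.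
  module Renaming (k : ℕ) (choose : PaletteChoosable k) (L : Fin m → List ℕ)
                  (L-ok : ∀ v → Unique (L v) × length (L v) ≡ k) where

    rename : ℕ → ℕ
    rename = position (allColors m L)

    renamed-bounded : ∀ v → All (_< m * k) (map rename (L v))
    renamed-bounded v = All.tabulate bounded
      where
      bounded : ∀ {y} → y ∈ map rename (L v) → y < m * k
      bounded y∈ with ∈-map⁻ rename y∈
      ... | x , x∈ , refl = subst (rename x <_) (length-allColors m L k (proj₂ ∘ L-ok))
                                  (position-< (allColors m L) (∈-allColors m L v x∈))

    renamed : ∀ v → Σ (Vec (Fin (m * k)) k) λ w → colors w ≡ map rename (L v)
    renamed v = colors-onto k (map rename (L v)) (renamed-bounded v) (trans (length-map rename (L v)) (proj₂ (L-ok v)))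

    L′ : Fin m → Vec (Fin (m * k)) k
    L′ = proj₁ ∘ renamed

    L′-unique : ∀ v → Unique (colors (L′ v))
    L′-unique v = subst Unique (sym (proj₂ (renamed v))) (UniqueProps.map⁺ (position-injective (allColors m L)) (proj₁ (L-ok v)))

    chosen : LDistinguishable A (colors ∘ L′)
    chosen = choose L′ L′-unique

    g : Fin m → ℕ
    g = proj₁ chosen

    f : Fin m → ℕ
    f = entry (allColors m L) ∘ g

    f-spec : ∀ v → f v ∈ L v × g v ≡ rename (f v)
    f-spec v with ∈-map⁻ rename (subst (g v ∈_) (proj₂ (renamed v)) (proj₁ (proj₂ chosen) v))
    ... | x , x∈ , g≡ = subst (λ y → y ∈ L v × g v ≡ rename y) (sym f≡x) (x∈ , g≡)
      where
      f≡x : f v ≡ x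
      f≡x = trans (cong (entry (allColors m L)) g≡) (entry-position (allColors m L) x)

    f-distinguishing : Distinguishing A f
    f-distinguishing σ a pres = proj₂ (proj₂ chosen) σ a
      (λ w → trans (proj₂ (f-spec (σ ⟨$⟩ʳ w))) (trans (cong rename (pres w)) (sym (proj₂ (f-spec w)))))

  palette→choosable : ∀ k → PaletteChoosable k → KChoosable A k
  palette→choosable k choose (L , L-ok) = f , proj₁ ∘ f-spec , f-distinguishing
    where open Renaming k choose L L-ok

  LDistinguishable? : ∀ {N k} (L : Fin m → Vec (Fin N) k) → Dec (LDistinguishable A (colors ∘ L))
  LDistinguishable? {N} L =
    map′ (λ (g , g∈ , d) → toℕ ∘ g , g∈ , d)
         (λ (f , f∈ , d) → let f<N = λ v → colors-bounded (L v) (f∈ v)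
                               back = λ v → sym (toℕ-fromℕ< (f<N v)) in
           (λ v → fromℕ< (f<N v)) , (λ v → subst (_∈ colors (L v)) (back v) (f∈ v)) , distinguishing-resp back d)
         (search-Fun (search-Fin N) m Chosen (λ g → all? (λ v → toℕ (g v) ∈? colors (L v)) ×-dec distinguishing? _)
                     (λ g≗h (g∈ , d) → (λ v → subst (λ c → toℕ c ∈ colors (L v)) (g≗h v) (g∈ v)) ,
                                        distinguishing-resp (cong toℕ ∘ g≗h) d))
    where
    Chosen : (Fin m → Fin N) → Set
    Chosen g = (∀ v → toℕ (g v) ∈ colors (L v)) × Distinguishing A (toℕ ∘ g)

  Counterexample : ∀ k → (Fin m → Vec (Fin (m * k)) k) → Set
  Counterexample k L = (∀ v → Unique (colors (L v))) × ¬ LDistinguishable A (colors ∘ L)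

  counterexample? : ∀ k → U.Decidable (Counterexample k)
  counterexample? k L = all? (λ v → unique? (colors (L v))) ×-dec ¬? (LDistinguishable? L)

  counterexample-resp : ∀ k → RespectsPointwise (Counterexample k)
  counterexample-resp k L≗L′ (unique , ¬ld) =
    (λ v → subst (Unique ∘ colors) (L≗L′ v) (unique v)) ,
    λ (f , f∈ , d) → ¬ld (f , (λ v → subst (λ w → f v ∈ colors w) (sym (L≗L′ v)) (f∈ v)) , d)

  -- There are finitely many palette assignments, so counterexamples can be searched for.
  PaletteChoosable? : ∀ k → Dec (PaletteChoosable k)
  PaletteChoosable? k
    with search-Fun (search-Vec (search-Fin (m * k)) k) m (Counterexample k) (counterexample? k) (counterexample-resp k)
  ... | yes (L , unique , ¬ld) = no λ choose → ¬ld (choose L unique)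
  ... | no none = yes λ L unique → decidable-stable (LDistinguishable? L) λ ¬ld → none (L , unique , ¬ld)

  KChoosable? : ∀ k → Dec (KChoosable A k)
  KChoosable? k = map′ (palette→choosable k) (choosable→palette k) (PaletteChoosable? k)

  -- m-lists always admit an injective, hence distinguishing, choice.
  choosable-m : KChoosable A m
  choosable-m (L , L-ok) with distinct-choice m L (proj₁ ∘ L-ok) (λ v → ≤-reflexive (sym (proj₂ (L-ok v))))
  ... | f , f∈ , f-inj = f , f∈ , injective-distinguishing f f-inj

  Dl-exists : Σ ℕ (IsDl A)
  Dl-exists = least KChoosable? m choosable-m

IsAut? : ∀ {m} (G : Graph m) → U.Decidable (IsAut G)
IsAut? G σ = all? λ u → all? λ v → adj G (σ ⟨$⟩ʳ u) (σ ⟨$⟩ʳ v) ≟B adj G u v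

IsAut-resp : ∀ {m} (G : Graph m) → PermRespects (IsAut G)
IsAut-resp G σ τ σ≈τ aut u v = trans (cong₂ (adj G) (sym (σ≈τ u)) (sym (σ≈τ v))) (aut u v)

IsD-transfer : ∀ {m m′} {A : Permutation′ m → Set} {B : Permutation′ m′ → Set} →
  (∀ k → KDistinguishable A k → KDistinguishable B k) → (∀ k → KDistinguishable B k → KDistinguishable A k) →
  ∀ {d} → IsD A d → IsD B d
IsD-transfer A→B B→A (kd , minimal) = A→B _ kd , λ k kdB → minimal k (B→A k kdB)

IsDl-transfer : ∀ {m m′} {A : Permutation′ m → Set} {B : Permutation′ m′ → Set} →
  (∀ k → KChoosable A k → KChoosable B k) → (∀ k → KChoosable B k → KChoosable A k) →
  ∀ {d} → IsDl A d → IsDl B d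
IsDl-transfer A→B B→A (ch , minimal) = A→B _ ch , λ k chB → minimal k (B→A k chB)

module _ {m} {A B : Permutation′ m → Set} (B⊆A : ∀ σ → B σ → A σ) where

  distinguishing-mono : ∀ {f} → Distinguishing A f → Distinguishing B f
  distinguishing-mono d σ b = d σ (B⊆A σ b)

  KDistinguishable-mono : ∀ k → KDistinguishable A k → KDistinguishable B k
  KDistinguishable-mono k (f , f<k , d) = f , f<k , distinguishing-mono d

  KChoosable-mono : ∀ k → KChoosable A k → KChoosable B k
  KChoosable-mono k ch L = let (f , f∈ , d) = ch L in f , f∈ , distinguishing-mono d

module _ {m} {A B : Permutation′ m → Set} (A⊆B : ∀ σ → A σ → B σ) (B⊆A : ∀ σ → B σ → A σ) where

  same-IsD : ∀ {d} → IsD A d → IsD B d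
  same-IsD = IsD-transfer (KDistinguishable-mono B⊆A) (KDistinguishable-mono A⊆B)

  same-IsDl : ∀ {d} → IsDl A d → IsDl B d
  same-IsDl = IsDl-transfer (KChoosable-mono B⊆A) (KChoosable-mono A⊆B)

-- Lists of equal length are empty together.
∈-same-length : ∀ {A : Set} {xs ys : List A} {y} → length xs ≡ length ys → y ∈ ys → ∃ (_∈ xs)
∈-same-length {xs = x ∷ _} _ _ = x , here refl
∈-same-length {xs = []} {_ ∷ _} () _

-- Let A act on Fin (suc M) and B on Fin (suc (suc M)) such
-- that the members of B are exactly the lifts of members of A fixing the new
-- root zero.  Then colorings distinguishing for A, extended by any root
-- color, are distinguishing for B, and conversely; so A and B have the same
-- D and D_ℓ.  (Nonemptiness of Fin (suc M) lets a root color be chosen from a list.)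
module RootExtension {M} (A : Permutation′ (suc M) → Set) (B : Permutation′ (suc (suc M)) → Set)
  (lift-B : ∀ σ → A σ → B (lift₀ σ))
  (restrict-A : ∀ σ → B σ → A (remove zero σ) × σ ⟨$⟩ʳ zero ≡ zero) where

  -- A member of B fixes the root and acts on the other vertices as its restriction.
  extend : ∀ f → Distinguishing A (f ∘ suc) → Distinguishing B f
  extend f d σ b pres v with restrict-A σ b
  extend f d σ b pres zero | _ , fixes = fixes
  extend f d σ b pres (suc v) | a , fixes =
    trans (sym (lift₀-remove σ fixes (suc v)))
          (cong suc (d (remove zero σ) a (λ w → trans (cong f (lift₀-remove σ fixes (suc w))) (pres (suc w))) v))

  -- A lift of a member of A acts on the old vertices as that member.
  restrict : ∀ f → Distinguishing B f → Distinguishing A (f ∘ suc)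
  restrict f d σ a pres v = suc-injective (d (lift₀ σ) (lift-B σ a) (λ { zero → refl ; (suc w) → pres w }) (suc v))

  KDistinguishable→ : ∀ k → KDistinguishable A k → KDistinguishable B k
  KDistinguishable→ k (f , f<k , d) = f zero ∷ᶠ f , (λ { zero → f<k zero ; (suc v) → f<k v }) , extend (f zero ∷ᶠ f) d

  KDistinguishable← : ∀ k → KDistinguishable B k → KDistinguishable A k
  KDistinguishable← k (f , f<k , d) = f ∘ suc , f<k ∘ suc , restrict f d

  KChoosable→ : ∀ k → KChoosable A k → KChoosable B k
  KChoosable→ k ch (L , L-ok) =
    let (f , f∈ , d) = ch (L ∘ suc , L-ok ∘ suc)
        (x , x∈) = ∈-same-length (trans (proj₂ (L-ok zero)) (sym (proj₂ (L-ok (suc zero))))) (f∈ zero)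
    in x ∷ᶠ f , (λ { zero → x∈ ; (suc v) → f∈ v }) , extend (x ∷ᶠ f) d

  KChoosable← : ∀ k → KChoosable B k → KChoosable A k
  KChoosable← k ch (L , L-ok) =
    let (f , f∈ , d) = ch (L zero ∷ᶠ L , λ { zero → L-ok zero ; (suc v) → L-ok v })
    in f ∘ suc , f∈ ∘ suc , restrict f d

  IsD⇒ : ∀ {d} → IsD A d → IsD B d
  IsD⇒ = IsD-transfer KDistinguishable→ KDistinguishable←

  IsDl⇒ : ∀ {d} → IsDl A d → IsDl B d
  IsDl⇒ = IsDl-transfer KChoosable→ KChoosable←

infix 4 _∈ᵥ_ _⊆ᵥ_

_∈ᵥ_ : ∀ {m} → Fin m → (Fin m → Bool) → Set
v ∈ᵥ S = S v ≡ true

_⊆ᵥ_ : ∀ {m} → (Fin m → Bool) → (Fin m → Bool) → Set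
S ⊆ᵥ S′ = ∀ v → v ∈ᵥ S → v ∈ᵥ S′

⟦_⟧ : ∀ {m} {P : Fin m → Set} → U.Decidable P → Fin m → Bool
⟦ P? ⟧ v = does (P? v)

∈⟦⟧⁻ : ∀ {m} {P : Fin m → Set} (P? : U.Decidable P) {v} → v ∈ᵥ ⟦ P? ⟧ → P v
∈⟦⟧⁻ P? {v} with P? v
... | yes p = λ _ → p
... | no _ = λ ()

∈⟦⟧⁺ : ∀ {m} {P : Fin m → Set} (P? : U.Decidable P) {v} → P v → v ∈ᵥ ⟦ P? ⟧
∈⟦⟧⁺ P? {v} = dec-true (P? v)

∉⟦⟧ : ∀ {m} {P : Fin m → Set} (P? : U.Decidable P) {v} → ¬ P v → ⟦ P? ⟧ v ≡ false
∉⟦⟧ P? {v} = dec-false (P? v)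

bit : Bool → ℕ
bit b = if b then 1 else 0

bit-mono : ∀ {b c} → (b ≡ true → c ≡ true) → bit b ≤ bit c
bit-mono {false} _ = z≤n
bit-mono {true} {true} _ = ≤-refl
bit-mono {true} {false} b⇒c = case b⇒c refl of λ ()

bit-< : ∀ {b c} → b ≡ false → c ≡ true → bit b < bit c
bit-< refl refl = s≤s z≤n

size : ∀ {m} → (Fin m → Bool) → ℕ
size {zero} S = 0
size {suc m} S = bit (S zero) + size (S ∘ suc)

size-mono : ∀ {m} {S S′ : Fin m → Bool} → S ⊆ᵥ S′ → size S ≤ size S′
size-mono {zero} _ = z≤n
size-mono {suc m} S⊆S′ = +-mono-≤ (bit-mono (S⊆S′ zero)) (size-mono (S⊆S′ ∘ suc))

size-< : ∀ {m} {S S′ : Fin m → Bool} → S ⊆ᵥ S′ → ∀ x → S x ≡ false → x ∈ᵥ S′ → size S < size S′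
size-< S⊆S′ zero x∉ x∈ = +-mono-<-≤ (bit-< x∉ x∈) (size-mono (S⊆S′ ∘ suc))
size-< S⊆S′ (suc x) x∉ x∈ = +-mono-≤-< (bit-mono (S⊆S′ zero)) (size-< (S⊆S′ ∘ suc) x x∉ x∈)

Invariant : ∀ {m} → Graph m → (Fin m → Bool) → Set
Invariant G S = ∀ σ → IsAut G σ → ∀ v → S (σ ⟨$⟩ʳ v) ≡ S v

-- An edge {a , b} with an invariant vertex set F such that a ∈ F ⊆ {a , b}.
-- (For a central edge F = {a , b}; only these properties are used.)
record CentralEdge {m} (G : Graph m) : Set where
  field
    F : Fin m → Bool
    a b : Fin m
    a∼b : Adj G a b
    a∈F : a ∈ᵥ F
    F⊆ab : ∀ x → x ∈ᵥ F → x ≡ a ⊎ x ≡ b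
    F-invariant : Invariant G F

data Center {m} (G : Graph m) : Set where
  vertex : (c : Fin m) → (∀ σ → IsAut G σ → σ ⟨$⟩ʳ c ≡ c) → Center G
  edge : CentralEdge G → Center G

-- Initial segments of lists.  On a repetition-free chain x, h, … linked by
-- adjacency, the segment up to a later neighbour z of x closes a cycle.
upTo : ∀ {A : Set} {z : A} (l : List A) → z ∈ l → List A
upTo (y ∷ l) (here _) = y ∷ []
upTo (y ∷ l) (there z∈) = y ∷ upTo l z∈

upTo-all : ∀ {A : Set} {P : A → Set} {z} {l : List A} → All P l → (z∈ : z ∈ l) → All P (upTo l z∈)
upTo-all (p ∷ _) (here _) = p ∷ []
upTo-all (p ∷ ps) (there z∈) = p ∷ upTo-all ps z∈

upTo-unique : ∀ {A : Set} {z : A} {l : List A} → Unique l → (z∈ : z ∈ l) → Unique (upTo l z∈)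
upTo-unique (_ ∷ _) (here _) = [] ∷ []
upTo-unique (y∉ ∷ un) (there z∈) = upTo-all y∉ z∈ ∷ upTo-unique un z∈

upTo-nonempty : ∀ {A : Set} {z : A} {l : List A} (z∈ : z ∈ l) → 1 ≤ length (upTo l z∈)
upTo-nonempty (here _) = s≤s z≤n
upTo-nonempty (there _) = s≤s z≤n

upTo-linked : ∀ {A : Set} {R : A → A → Set} {a z b : A} {l : List A} → Linked R (a ∷ l) → (z∈ : z ∈ l) →
  R z b → Linked R (a ∷ upTo l z∈ ++ b ∷ [])
upTo-linked (r ∷ _) (here refl) rzb = r ∷ rzb ∷ [-]
upTo-linked (r ∷ lk) (there z∈) rzb = r ∷ upTo-linked lk z∈ rzb

module _ {A : Set} {R : A → A → Set} where

  linked-split : ∀ (l₁ : List A) {y l₂} → Linked R (l₁ ++ y ∷ l₂) → Linked R (l₁ ∷ʳ y) × Linked R (y ∷ l₂)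
  linked-split [] lk = [-] , lk
  linked-split (a ∷ []) (r ∷ lk) = r ∷ [-] , lk
  linked-split (a ∷ a′ ∷ l) (r ∷ lk) = let (lk₁ , lk₂) = linked-split (a′ ∷ l) lk in r ∷ lk₁ , lk₂

  linked-join : ∀ (l₁ : List A) {y l₂} → Linked R (l₁ ∷ʳ y) → Linked R (y ∷ l₂) → Linked R (l₁ ++ y ∷ l₂)
  linked-join [] _ lk₂ = lk₂
  linked-join (a ∷ []) (r ∷ [-]) lk₂ = r ∷ lk₂
  linked-join (a ∷ a′ ∷ l) (r ∷ lk₁) lk₂ = r ∷ linked-join (a′ ∷ l) lk₁ lk₂

-- Repeatedly deleting all leaves of a tree keeps an
-- invariant, connected, nonempty vertex set, until no vertex of it has two
-- neighbours inside it; such a set is a single vertex or an edge.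
module TreeCenter {m} (G : Graph m) where
  open DecMembership (_≟F_ {m}) using (_∈?_)

  adj-sym : ∀ {u w} → Adj G u w → Adj G w u
  adj-sym {u} {w} u∼w = trans (Graph.sym G w u) u∼w

  adj-irrefl : ∀ {x z} → Adj G x z → z ≢ x
  adj-irrefl {x} x∼x refl = case trans (sym x∼x) (Graph.irrefl G x) of λ ()

  aut-inverse : ∀ {σ} → IsAut G σ → IsAut G (flip σ)
  aut-inverse {σ} aut u v =
    trans (sym (aut (σ ⟨$⟩ˡ u) (σ ⟨$⟩ˡ v))) (cong₂ (adj G) (inverseʳ σ) (inverseʳ σ))

  Inner : (Fin m → Bool) → Fin m → Set
  Inner S v = ∃₂ λ u w → u ∈ᵥ S × w ∈ᵥ S × u ≢ w × Adj G v u × Adj G v w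

  Kept : (Fin m → Bool) → Fin m → Set
  Kept S v = v ∈ᵥ S × Inner S v

  kept? : ∀ S → U.Decidable (Kept S)
  kept? S v = (S v ≟B true) ×-dec
    any? λ u → any? λ w → (S u ≟B true) ×-dec (S w ≟B true) ×-dec ¬? (u ≟F w)
                          ×-dec (adj G v u ≟B true) ×-dec (adj G v w ≟B true)

  prune : (Fin m → Bool) → Fin m → Bool
  prune S = ⟦ kept? S ⟧

  -- Automorphisms preserve inner vertices of invariant sets, hence pruning preserves invariance.
  kept-image : ∀ {S v} σ → Invariant G S → IsAut G σ → Kept S v → Kept S (σ ⟨$⟩ʳ v)
  kept-image {S} {v} σ inv aut (v∈ , u , w , u∈ , w∈ , u≢w , v∼u , v∼w) =
    moved v∈ , σ ⟨$⟩ʳ u , σ ⟨$⟩ʳ w , moved u∈ , moved w∈ , σu≢σw , trans (aut v u) v∼u , trans (aut v w) v∼w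
    where
    moved : ∀ {x} → x ∈ᵥ S → σ ⟨$⟩ʳ x ∈ᵥ S
    moved {x} x∈ = trans (inv σ aut x) x∈
    σu≢σw : σ ⟨$⟩ʳ u ≢ σ ⟨$⟩ʳ w
    σu≢σw e = u≢w (trans (sym (inverseˡ σ)) (trans (cong (σ ⟨$⟩ˡ_) e) (inverseˡ σ)))

  prune-invariant : ∀ {S} → Invariant G S → Invariant G (prune S)
  prune-invariant {S} inv σ aut v = does-⇔ (mk⇔ preimage (kept-image σ inv aut)) (kept? S _) (kept? S v)
    where
    preimage : Kept S (σ ⟨$⟩ʳ v) → Kept S v
    preimage k = subst (Kept S) (inverseˡ σ) (kept-image (flip σ) inv (aut-inverse {σ} aut) k)

  data WalkIn (S : Fin m → Bool) : Fin m → Fin m → Set where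
    nil : ∀ {u} → u ∈ᵥ S → WalkIn S u u
    cons : ∀ {u w v} → u ∈ᵥ S → Adj G u w → WalkIn S w v → WalkIn S u v

  vertices : ∀ {S u v} → WalkIn S u v → List (Fin m)
  vertices (nil {u} _) = u ∷ []
  vertices (cons {u} _ _ w) = u ∷ vertices w

  start∈S : ∀ {S u v} → WalkIn S u v → u ∈ᵥ S
  start∈S (nil u∈) = u∈
  start∈S (cons u∈ _ _) = u∈

  start∈vertices : ∀ {S u v} (w : WalkIn S u v) → u ∈ vertices w
  start∈vertices (nil _) = here refl
  start∈vertices (cons _ _ _) = here refl

  ConnectedIn : (Fin m → Bool) → Set
  ConnectedIn S = ∀ u v → u ∈ᵥ S → v ∈ᵥ S → WalkIn S u v

  Path : (Fin m → Bool) → Fin m → Fin m → Set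
  Path S u v = Σ (WalkIn S u v) (Unique ∘ vertices)

  suffix : ∀ {S x u v} (p : Path S x v) → u ∈ vertices (proj₁ p) → Path S u v
  suffix (nil u∈ , un) (here refl) = nil u∈ , un
  suffix (cons x∈ x∼y w , un) (here refl) = cons x∈ x∼y w , un
  suffix (cons _ _ w , _ ∷ un) (there u∈) = suffix (w , un) u∈

  shorten : ∀ {S u v} → WalkIn S u v → Path S u v
  shorten (nil u∈) = nil u∈ , [] ∷ []
  shorten (cons {u} u∈ u∼w w) with shorten w
  ... | p with u ∈? vertices (proj₁ p)
  ...   | yes u∈p = suffix p u∈p
  ...   | no u∉p = cons u∈ u∼w (proj₁ p) , ¬Any⇒All¬ _ u∉p ∷ proj₂ p

  kept⁺ : ∀ {S v} → v ∈ᵥ S → Inner S v → v ∈ᵥ prune S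
  kept⁺ {S} v∈ inner = ∈⟦⟧⁺ (kept? S) (v∈ , inner)

  -- Along a path inside S, every vertex but the ends has its two path
  -- neighbours in S, so the path lies inside prune S when its ends do.
  path-in-prune : ∀ {S x v} (p : Path S x v) → ∀ pre → pre ∈ᵥ S → Adj G x pre →
    pre ∉ vertices (proj₁ p) → v ∈ᵥ prune S → WalkIn (prune S) x v
  path-in-prune (nil _ , _) _ _ _ _ v∈ = nil v∈
  path-in-prune {S} (cons {x} {y} x∈ x∼y w , x∉ ∷ un) pre pre∈ x∼pre pre∉ v∈ =
    cons (kept⁺ x∈ (pre , y , pre∈ , start∈S w , pre≢y , x∼pre , x∼y)) x∼y
         (path-in-prune (w , un) x x∈ (adj-sym x∼y) (λ x∈w → All.lookup x∉ x∈w refl) v∈)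
    where
    pre≢y : pre ≢ y
    pre≢y refl = pre∉ (there (start∈vertices w))

  prune-connected : ∀ {S} → ConnectedIn S → ConnectedIn (prune S)
  prune-connected {S} conn u v u∈ v∈ with shorten (conn u v (proj₁ (∈⟦⟧⁻ (kept? S) u∈)) (proj₁ (∈⟦⟧⁻ (kept? S) v∈)))
  ... | nil _ , _ = nil u∈
  ... | cons u∈S u∼y w , u∉ ∷ un =
    cons u∈ u∼y (path-in-prune (w , un) u u∈S (adj-sym u∼y) (λ u∈w → All.lookup u∉ u∈w refl) v∈)

  Avoids : (Fin m → Bool) → List (Fin m) → Fin m → Set
  Avoids S p v = v ∈ᵥ S × v ∉ p

  avoids? : ∀ S p → U.Decidable (Avoids S p)
  avoids? S p v = (S v ≟B true) ×-dec ¬? (v ∈? p)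

  avoiding : (Fin m → Bool) → List (Fin m) → Fin m → Bool
  avoiding S p = ⟦ avoids? S p ⟧

  avoiding⊆ : ∀ S p → avoiding S p ⊆ᵥ S
  avoiding⊆ S p v v∈ = proj₁ (∈⟦⟧⁻ (avoids? S p) v∈)

  avoiding-shrinks : ∀ S p {y} → y ∈ᵥ S → y ∉ p → size (avoiding S (y ∷ p)) < size (avoiding S p)
  avoiding-shrinks S p {y} y∈ y∉ =
    size-< shrink y (∉⟦⟧ (avoids? S (y ∷ p)) λ (_ , y∉y∷p) → y∉y∷p (here refl)) (∈⟦⟧⁺ (avoids? S p) (y∈ , y∉))
    where
    shrink : avoiding S (y ∷ p) ⊆ᵥ avoiding S p
    shrink v v∈ = let (v∈S , v∉) = ∈⟦⟧⁻ (avoids? S (y ∷ p)) v∈ in ∈⟦⟧⁺ (avoids? S p) (v∈S , v∉ ∘ there)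

  no-chord : Acyclic G → ∀ {x h rest z} → Linked (Adj G) (x ∷ h ∷ rest) → Unique (x ∷ h ∷ rest) →
    z ∈ rest → ¬ Adj G x z
  no-chord acyclic {x} (x∼h ∷ lk) ((x∉h ∷ x∉rest) ∷ (h∉rest ∷ un)) z∈ x∼z =
    acyclic x (_ ∷ upTo _ z∈)
      (s≤s (upTo-nonempty z∈) , (x∉h ∷ upTo-all x∉rest z∈) ∷ (upTo-all h∉rest z∈ ∷ upTo-unique un z∈) ,
       x∼h ∷ upTo-linked lk z∈ (adj-sym x∼z))

  maximal-path-end : Acyclic G → ∀ {S x xs} → Linked (Adj G) (x ∷ xs) → Unique (x ∷ xs) →
    (∀ z → z ∈ᵥ S → Adj G x z → z ∈ xs) → ¬ Inner S x
  maximal-path-end acyclic {xs = []} lk un on-path (u , _ , u∈ , _ , _ , x∼u , _) with on-path u u∈ x∼u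
  ... | ()
  maximal-path-end acyclic {xs = h ∷ rest} lk un on-path (u , w , u∈ , w∈ , u≢w , x∼u , x∼w)
    with on-path u u∈ x∼u | on-path w w∈ x∼w
  ... | there u∈rest | _ = no-chord acyclic lk un u∈rest x∼u
  ... | here _ | there w∈rest = no-chord acyclic lk un w∈rest x∼w
  ... | here refl | here refl = u≢w refl

  -- Extend a path inside S while possible; its end is then a leaf of S.
  leaf-from : Acyclic G → ∀ {S} fuel x xs → size (avoiding S (x ∷ xs)) < fuel →
    Linked (Adj G) (x ∷ xs) → Unique (x ∷ xs) → All (_∈ᵥ S) (x ∷ xs) → ∃ λ z → z ∈ᵥ S × ¬ Inner S z
  leaf-from acyclic {S} (suc fuel) x xs (s≤s bound) lk un in-S
    with any? (λ y → (S y ≟B true) ×-dec (adj G x y ≟B true) ×-dec ¬? (y ∈? (x ∷ xs)))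
  ... | yes (y , y∈ , x∼y , y∉) =
    leaf-from acyclic fuel y (x ∷ xs) (<-≤-trans (avoiding-shrinks S (x ∷ xs) y∈ y∉) bound)
              (adj-sym x∼y ∷ lk) (¬Any⇒All¬ _ y∉ ∷ un) (y∈ ∷ in-S)
  ... | no stuck = x , All.head in-S , maximal-path-end acyclic lk un on-path
    where
    on-path : ∀ z → z ∈ᵥ S → Adj G x z → z ∈ xs
    on-path z z∈ x∼z with decidable-stable (z ∈? (x ∷ xs)) (λ z∉ → stuck (z , z∈ , x∼z , z∉))
    ... | here z≡x = ⊥-elim (adj-irrefl x∼z z≡x)
    ... | there z∈xs = z∈xs

  leaf : Acyclic G → ∀ {S x} → x ∈ᵥ S → ∃ λ z → z ∈ᵥ S × ¬ Inner S z
  leaf acyclic {S} {x} x∈ =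
    leaf-from acyclic (suc (size S)) x [] (s≤s (size-mono (avoiding⊆ S (x ∷ []))))
              [-] ([] ∷ []) (x∈ ∷ [])

  record Core (S : Fin m → Bool) : Set where
    field
      invariant : Invariant G S
      connected : ConnectedIn S
      point : Fin m
      point∈ : point ∈ᵥ S
      no-inner : ∀ x → x ∈ᵥ S → ¬ Inner S x

  pruned⊆ : ∀ S → prune S ⊆ᵥ S
  pruned⊆ S v v∈ = proj₁ (∈⟦⟧⁻ (kept? S) v∈)

  -- Pruning repeatedly: while pruning leaves something it removes a leaf, so
  -- the size drops; the last nonempty set reached is a core.
  prune-to-core : Acyclic G → ∀ fuel S → size S < fuel → Invariant G S → ConnectedIn S → ∃ (_∈ᵥ S) → Σ _ Core
  prune-to-core acyclic (suc fuel) S (s≤s small) inv conn (x , x∈) with any? (λ v → prune S v ≟B true)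
  ... | no empty = S , record { invariant = inv ; connected = conn ; point = x ; point∈ = x∈
                              ; no-inner = λ y y∈ inner → empty (y , kept⁺ y∈ inner) }
  ... | yes nonempty =
    let (z , z∈ , z-leaf) = leaf acyclic x∈
        shrinks = size-< (pruned⊆ S) z (∉⟦⟧ (kept? S) (z-leaf ∘ proj₂)) z∈
    in prune-to-core acyclic fuel (prune S) (<-≤-trans shrinks small)
                     (prune-invariant inv) (prune-connected conn) nonempty

  -- In a set without inner vertices, the ends of a path of length at least
  -- two would make its second vertex inner; so distinct vertices are adjacent.
  path-adjacent : ∀ {S} → (∀ x → x ∈ᵥ S → ¬ Inner S x) → ∀ {a c} → Path S a c → a ≢ c → Adj G a c
  path-adjacent no-inner (nil _ , _) a≢c = ⊥-elim (a≢c refl)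
  path-adjacent no-inner (cons _ a∼c (nil _) , _) _ = a∼c
  path-adjacent no-inner (cons {a} a∈ a∼y (cons y∈ y∼z w) , (a∉ ∷ _)) _ =
    ⊥-elim (no-inner _ y∈ (a , _ , a∈ , start∈S w , All.lookup a∉ (there (start∈vertices w)) , adj-sym a∼y , y∼z))

  core→center : ∀ {S} → Core S → Center G
  core→center {S} record { invariant = inv ; connected = conn ; point = a ; point∈ = a∈ ; no-inner = no-inner }
    with any? (λ b → (S b ≟B true) ×-dec ¬? (b ≟F a))
  ... | no alone = vertex a λ σ aut →
    decidable-stable (σ ⟨$⟩ʳ a ≟F a) λ moved → alone (σ ⟨$⟩ʳ a , trans (inv σ aut a) a∈ , moved)
  ... | yes (b , b∈ , b≢a) = edge record
    { F = S ; a = a ; b = b ; a∼b = adjacent b∈ (b≢a ∘ sym) ; a∈F = a∈ ; F⊆ab = F⊆ab ; F-invariant = inv }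
    where
    adjacent : ∀ {x} → x ∈ᵥ S → a ≢ x → Adj G a x
    adjacent x∈ = path-adjacent no-inner (shorten (conn _ _ a∈ x∈))
    F⊆ab : ∀ x → x ∈ᵥ S → x ≡ a ⊎ x ≡ b
    F⊆ab x x∈ with x ≟F a | x ≟F b
    ... | yes x≡a | _ = inj₁ x≡a
    ... | no _ | yes x≡b = inj₂ x≡b
    ... | no x≢a | no x≢b =
      ⊥-elim (no-inner a a∈ (b , x , b∈ , x∈ , x≢b ∘ sym , adjacent b∈ (b≢a ∘ sym) , adjacent x∈ (x≢a ∘ sym)))

  walk-in-everything : ∀ {u v} → Walk G u v → WalkIn (λ _ → true) u v
  walk-in-everything here = nil refl
  walk-in-everything (step u∼w w) = cons refl u∼w (walk-in-everything w)

  center : IsTree G → Fin m → Center G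
  center (conn , acyclic) x₀ =
    core→center (proj₂ (prune-to-core acyclic (suc (size everything)) everything ≤-refl (λ _ _ _ → refl)
                                      (λ u v _ _ → walk-in-everything (conn u v)) (x₀ , refl)))
    where
    everything : Fin m → Bool
    everything _ = true

rotate-cycle : ∀ {m} (G : Graph m) x ys z zs → IsCycle G x (ys ++ z ∷ zs) → IsCycle G z (zs ++ x ∷ ys)
rotate-cycle {m} G x ys z zs (long , unique , linked) = long′ , unique′ , linked′
  where
  open PermutationProps (setoid (Fin m)) using (Unique-resp-↭; ++-comm)
  long′ : 2 ≤ length (zs ++ x ∷ ys)
  long′ = subst (2 ≤_) (trans (length-++-sucʳ ys z zs)
                   (trans (cong suc (length-++-comm ys zs)) (sym (length-++-sucʳ zs x ys)))) long
  unique′ : Unique (z ∷ zs ++ x ∷ ys)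
  unique′ = Unique-resp-↭ (++-comm (x ∷ ys) (z ∷ zs)) unique
  halves : Linked (Adj G) (x ∷ ys ∷ʳ z) × Linked (Adj G) (z ∷ zs ++ x ∷ [])
  halves = linked-split (x ∷ ys) (subst (Linked (Adj G) ∘ (x ∷_)) (++-assoc ys (z ∷ zs) (x ∷ [])) linked)
  linked′ : Linked (Adj G) (z ∷ (zs ++ x ∷ ys) ++ z ∷ [])
  linked′ = subst (Linked (Adj G) ∘ (z ∷_)) (sym (++-assoc zs (x ∷ ys) (z ∷ [])))
                  (linked-join (z ∷ zs) (proj₂ halves) (proj₁ halves))

unsuc : ∀ {M} (l : List (Fin (suc M))) → zero ∉ l → Σ (List (Fin M)) λ l′ → l ≡ map suc l′
unsuc [] _ = [] , refl
unsuc (zero ∷ l) zero∉ = ⊥-elim (zero∉ (here refl))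
unsuc (suc x ∷ l) zero∉ = let (l′ , eq) = unsuc l (zero∉ ∘ there) in x ∷ l′ , cong (suc x ∷_) eq

not-both : ∀ x {y z} → y ≡ true → z ≡ true → x ∧ not (y ∧ z) ≢ true
not-both true refl refl ()
not-both false refl refl ()

not-both-kept : ∀ {x} y z → x ≡ true → y ∧ z ≡ false → x ∧ not (y ∧ z) ≡ true
not-both-kept y z refl y∧z≡false rewrite y∧z≡false = refl

-- Subdividing the central edge {a , b}: T′ has a new vertex zero adjacent
-- exactly to a and b (that is, to F), and the edge {a , b} is removed.
module Subdivision {M} (T : Graph M) (edge : CentralEdge T) where
  open CentralEdge edge
  open DecMembership (_≟F_ {suc M}) using (_∈?_)

  adj′ : Fin (suc M) → Fin (suc M) → Bool
  adj′ zero zero = false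
  adj′ zero (suc v) = F v
  adj′ (suc u) zero = F u
  adj′ (suc u) (suc v) = adj T u v ∧ not (F u ∧ F v)

  adj′-sym : ∀ u v → adj′ u v ≡ adj′ v u
  adj′-sym zero zero = refl
  adj′-sym zero (suc v) = refl
  adj′-sym (suc u) zero = refl
  adj′-sym (suc u) (suc v) = cong₂ (λ p q → p ∧ not q) (Graph.sym T u v) (∧-comm (F u) (F v))

  adj′-irrefl : ∀ v → adj′ v v ≡ false
  adj′-irrefl zero = refl
  adj′-irrefl (suc v) rewrite Graph.irrefl T v = refl

  T′ : Graph (suc M)
  T′ = record { adj = adj′ ; sym = adj′-sym ; irrefl = adj′-irrefl }

  F-adjacent : ∀ {x y} → x ∈ᵥ F → y ∈ᵥ F → x ≢ y → Adj T x y
  F-adjacent {x} {y} x∈ y∈ x≢y with F⊆ab x x∈ | F⊆ab y y∈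
  ... | inj₁ refl | inj₁ refl = ⊥-elim (x≢y refl)
  ... | inj₁ refl | inj₂ refl = a∼b
  ... | inj₂ refl | inj₁ refl = trans (Graph.sym T b a) a∼b
  ... | inj₂ refl | inj₂ refl = ⊥-elim (x≢y refl)

  _++ʷ_ : ∀ {u v w} → Walk T′ u v → Walk T′ v w → Walk T′ u w
  here ++ʷ q = q
  step e p ++ʷ q = step e (p ++ʷ q)

  -- An edge of T is an edge of T′, or a walk through the new vertex if it was removed.
  lift-edge : ∀ {x y} → Adj T x y → Walk T′ (suc x) (suc y)
  lift-edge {x} {y} x∼y with F x in x∈? | F y in y∈?
  ... | true | true = step {w = zero} x∈? (step y∈? here)
  ... | true | false = step (not-both-kept (F x) (F y) x∼y (trans (cong (_∧ F y) x∈?) y∈?)) here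
  ... | false | _ = step (not-both-kept (F x) (F y) x∼y (cong (_∧ F y) x∈?)) here

  lift-walk : ∀ {u v} → Walk T u v → Walk T′ (suc u) (suc v)
  lift-walk here = here
  lift-walk (step e w) = lift-edge e ++ʷ lift-walk w

  connected′ : Connected T → Connected T′
  connected′ conn zero zero = here
  connected′ conn zero (suc v) = step a∈F (lift-walk (conn a v))
  connected′ conn (suc u) zero = lift-walk (conn u a) ++ʷ step a∈F here
  connected′ conn (suc u) (suc v) = lift-walk (conn u v)

  lower-edge : ∀ {u v} → Adj T′ (suc u) (suc v) → Adj T u v
  lower-edge {u} {v} e = ∧-conicalˡ (adj T u v) _ e

  lower-linked : ∀ (l : List (Fin M)) → Linked (Adj T′) (map suc l) → Linked (Adj T) l
  lower-linked l lk = Linked.map lower-edge (LinkedProps.map⁻ lk)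

  cycle-avoiding-root : Acyclic T → ∀ x xs → ¬ IsCycle T′ (suc x) (map suc xs)
  cycle-avoiding-root acyclic x xs (long , unique , linked) =
    acyclic x xs (subst (2 ≤_) (length-map suc xs) long , UniqueProps.map⁻ unique ,
                  lower-linked (x ∷ xs ++ x ∷ []) (subst (Linked (Adj T′) ∘ (suc x ∷_)) (sym (map-++ suc xs (x ∷ []))) linked))

  root-neighbours : ∀ p mid q → Linked (Adj T′) (zero ∷ map suc (p ∷ mid ∷ʳ q) ++ zero ∷ []) →
    p ∈ᵥ F × q ∈ᵥ F × Linked (Adj T′) (map suc (p ∷ mid ∷ʳ q))
  root-neighbours p mid q linked with linked-split (zero ∷ map suc (p ∷ mid)) (subst (Linked (Adj T′) ∘ (zero ∷_)) reassociate linked)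
    where
    reassociate : map suc (p ∷ mid ∷ʳ q) ++ zero ∷ [] ≡ map suc (p ∷ mid) ++ suc q ∷ zero ∷ []
    reassociate = trans (cong (_++ zero ∷ []) (map-++ suc (p ∷ mid) (q ∷ []))) (++-assoc (map suc (p ∷ mid)) (suc q ∷ []) (zero ∷ []))
  ... | zero∼p ∷ path , q∼zero ∷ _ = zero∼p , q∼zero , subst (Linked (Adj T′)) (sym (map-++ suc (p ∷ mid) (q ∷ []))) path

  -- Leaving the new vertex to p ∈ F and returning from q ∈ F, a cycle of T′
  -- yields either the removed edge {p , q} or a path p … q of T, closed by the edge q p of T into a cycle.
  cycle-through-root : Acyclic T → ∀ p mid q → ¬ IsCycle T′ zero (map suc (p ∷ mid ∷ʳ q))
  cycle-through-root acyclic p [] q (_ , _ , linked) with root-neighbours p [] q linked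
  ... | p∈ , q∈ , p∼q ∷ _ = not-both (adj T p q) p∈ q∈ p∼q
  cycle-through-root acyclic p (r ∷ rs) q (_ , _ ∷ unique , linked) =
    acyclic p (r ∷ rs ∷ʳ q) (s≤s long , unique-T , closed)
    where
    parts : p ∈ᵥ F × q ∈ᵥ F × Linked (Adj T′) (map suc (p ∷ r ∷ rs ∷ʳ q))
    parts = root-neighbours p (r ∷ rs) q linked
    unique-T : Unique (p ∷ r ∷ rs ∷ʳ q)
    unique-T = UniqueProps.map⁻ unique
    q≢p : q ≢ p
    q≢p q≡p = UniqueProps.Unique[x∷xs]⇒x∉xs unique-T (∈-++⁺ʳ (r ∷ rs) (here (sym q≡p)))
    long : 1 ≤ length (rs ∷ʳ q)
    long = subst (1 ≤_) (sym (length-++-sucʳ rs q [])) (s≤s z≤n)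
    closed : Linked (Adj T) (p ∷ (r ∷ rs ∷ʳ q) ++ p ∷ [])
    closed = subst (Linked (Adj T) ∘ (p ∷_)) (sym (++-assoc (r ∷ rs) (q ∷ []) (p ∷ [])))
               (linked-join (p ∷ r ∷ rs) (lower-linked (p ∷ r ∷ rs ∷ʳ q) (proj₂ (proj₂ parts)))
                            (F-adjacent (proj₁ (proj₂ parts)) (proj₁ parts) q≢p ∷ [-]))

  cycle-at-root : Acyclic T → ∀ xs → ¬ IsCycle T′ zero xs
  cycle-at-root acyclic xs cycle@(long , zero∉ ∷ _ , _) with unsuc xs (λ zero∈ → All.lookup zero∉ zero∈ refl)
  ... | [] , refl = case long of λ ()
  ... | p ∷ rs , refl = split-last rs (subst (1 ≤_) (length-map suc rs) (≤-pred long)) cycle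
    where
    split-last : ∀ rs → 1 ≤ length rs → ¬ IsCycle T′ zero (map suc (p ∷ rs))
    split-last rs with initLast rs
    ... | [] = λ ()
    ... | mid ∷ʳ′ q = λ _ → cycle-through-root acyclic p mid q

  -- Rotate a cycle through the new vertex to start there; other cycles avoid it.
  acyclic′ : Acyclic T → Acyclic T′
  acyclic′ acyclic x xs cycle with zero ∈? (x ∷ xs)
  ... | yes (here refl) = cycle-at-root acyclic xs cycle
  ... | yes (there zero∈) with ∈-∃++ zero∈
  ...   | ys , zs , refl = cycle-at-root acyclic (zs ++ x ∷ ys) (rotate-cycle T′ x ys zero zs cycle)
  acyclic′ acyclic x xs cycle | no zero∉ with unsuc (x ∷ xs) zero∉
  ... | x′ ∷ xs′ , refl = cycle-avoiding-root acyclic x′ xs′ cycle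

  tree′ : IsTree T → IsTree T′
  tree′ (conn , acyclic) = connected′ conn , acyclic′ acyclic

  -- Since F is invariant, automorphisms of T lift to automorphisms of T′
  -- fixing the new vertex, and every such automorphism arises this way.
  lift-aut : ∀ σ → IsAut T σ → IsRootedAut T′ zero (lift₀ σ)
  lift-aut σ aut = lifted , refl
    where
    lifted : IsAut T′ (lift₀ σ)
    lifted zero zero = refl
    lifted zero (suc v) = F-invariant σ aut v
    lifted (suc u) zero = F-invariant σ aut u
    lifted (suc u) (suc v) =
      cong₂ (λ p q → p ∧ not q) (aut u v) (cong₂ _∧_ (F-invariant σ aut u) (F-invariant σ aut v))

  restrict-aut : ∀ σ → IsRootedAut T′ zero σ → IsAut T (remove zero σ) × σ ⟨$⟩ʳ zero ≡ zero
  restrict-aut σ (aut , fixes) = restricted , fixes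
    where
    ρ : Permutation′ M
    ρ = remove zero σ
    on-suc : ∀ v → suc (ρ ⟨$⟩ʳ v) ≡ σ ⟨$⟩ʳ suc v
    on-suc v = lift₀-remove σ fixes (suc v)
    -- T′-adjacency of the new vertex shows that ρ preserves F.
    ρ-preserves-F : ∀ v → F (ρ ⟨$⟩ʳ v) ≡ F v
    ρ-preserves-F v = trans (cong₂ adj′ (sym fixes) (on-suc v)) (aut zero (suc v))
    ρ-injective : ∀ {u v} → ρ ⟨$⟩ʳ u ≡ ρ ⟨$⟩ʳ v → u ≡ v
    ρ-injective {u} {v} e = trans (sym (inverseˡ ρ)) (trans (cong (ρ ⟨$⟩ˡ_) e) (inverseˡ ρ))
    -- T′-adjacency of old vertices: T-adjacency outside the removed edge is preserved.
    outside-F : ∀ u v → adj T (ρ ⟨$⟩ʳ u) (ρ ⟨$⟩ʳ v) ∧ not (F u ∧ F v) ≡ adj T u v ∧ not (F u ∧ F v)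
    outside-F u v = trans (cong (λ f → adj T (ρ ⟨$⟩ʳ u) (ρ ⟨$⟩ʳ v) ∧ not f) (sym (cong₂ _∧_ (ρ-preserves-F u) (ρ-preserves-F v))))
                          (trans (cong₂ adj′ (on-suc u) (on-suc v)) (aut (suc u) (suc v)))
    -- Inside F, adjacency is distinctness, which ρ preserves.
    inside-F : ∀ u v → u ∈ᵥ F → v ∈ᵥ F → adj T (ρ ⟨$⟩ʳ u) (ρ ⟨$⟩ʳ v) ≡ adj T u v
    inside-F u v u∈ v∈ with u ≟F v
    ... | yes refl = trans (Graph.irrefl T _) (sym (Graph.irrefl T u))
    ... | no u≢v = trans (F-adjacent (trans (ρ-preserves-F u) u∈) (trans (ρ-preserves-F v) v∈) (u≢v ∘ ρ-injective))
                         (sym (F-adjacent u∈ v∈ u≢v))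
    restricted : IsAut T ρ
    restricted u v with F u in u∈ | F v in v∈ | outside-F u v
    ... | true | true | _ = inside-F u v u∈ v∈
    ... | true | false | same = trans (sym (∧-identityʳ _)) (trans same (∧-identityʳ _))
    ... | false | true | same = trans (sym (∧-identityʳ _)) (trans same (∧-identityʳ _))
    ... | false | false | same = trans (sym (∧-identityʳ _)) (trans same (∧-identityʳ _))

RootedTwin : ∀ {n} → Graph (suc n) → Set
RootedTwin T =
  Σ ℕ λ m → Σ (Graph (suc m)) λ T′ → Σ (Fin (suc m)) λ r → IsTree T′ ×
    Σ ℕ λ d → Σ ℕ λ dl →
      (IsD (IsAut T) d × IsD (IsRootedAut T′ r) d) × (IsDl (IsAut T) dl × IsDl (IsRootedAut T′ r) dl)

root-at-center : ∀ {n} (T : Graph (suc n)) → IsTree T → Center T →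
  Σ ℕ (IsD (IsAut T)) → Σ ℕ (IsDl (IsAut T)) → RootedTwin T
root-at-center {n} T tree (vertex c fixed) (d , isD) (dl , isDl) =
  n , T , c , tree , d , dl , (isD , same-IsD rooted (λ _ → proj₁) isD) , (isDl , same-IsDl rooted (λ _ → proj₁) isDl)
  where
  rooted : ∀ σ → IsAut T σ → IsRootedAut T c σ
  rooted σ aut = aut , fixed σ aut
root-at-center {n} T tree (edge central) (d , isD) (dl , isDl) =
  suc n , T′ , zero , tree′ tree , d , dl , (isD , IsD⇒ isD) , (isDl , IsDl⇒ isDl)
  where
  open Subdivision T central
  open RootExtension (IsAut T) (IsRootedAut T′ zero) lift-aut restrict-aut

lemma2 : (n : ℕ) (T : Graph (suc n)) → IsTree T →
    Σ ℕ λ m → Σ (Graph (suc m)) λ T' → Σ (Fin (suc m)) λ r → IsTree T' ×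
      Σ ℕ λ d → Σ ℕ λ dl →
        (IsD (IsAut T) d × IsD (IsRootedAut T' r) d) ×
        (IsDl (IsAut T) dl × IsDl (IsRootedAut T' r) dl)
lemma2 n T tree = root-at-center T tree (TreeCenter.center T tree zero) D-exists Dl-exists
  where open Existence (IsAut T) (IsAut? T) (IsAut-resp T)
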